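{- Let $S\subseteq\mathbb N^d$ be a good semigroup, $E\subseteq S$ a good ideal with conductor $c_E$, $U\subseteq I$ nonempty and $F\subsetneq U$. Let $\alpha(U)$ be a $U$-subspace of $E$. Then: 1. For a $U$-subspace $\beta(U)$: $\beta(U)\in\Delta^E_F(\alpha(U))$ if and only if $\beta\in\Delta^E_{F\cup\widehat U}(\alpha)$; and $\beta(U)\in\widetilde\Delta^E_F(\alpha(U))$ if and only if $\beta\in\widetilde\Delta^E_{F\cup\widehat U}(\alpha)$. 2. If $\widehat F\cap U\subseteq G\subseteq U$ and $\beta(U)$ is a $U$-subspace of $E$, then $\beta(U)\in\widetilde\Delta^E_G(\alpha(U))$ if and only if $\beta\in\widetilde\Delta^E_G(\alpha)$. The analogous statements hold with $E$ replaced by $A=S\setminus E$ or by a level $A_i$ of $A$.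
   Context: $I=\{1,\dots,d\}$, $\le$ componentwise order on $\mathbb N^d$, $\widehat F=I\setminus F$. A good semigroup is a submonoid $S$ of $(\mathbb N^d,+)$ with (G1) $\alpha\wedge\beta\in S$ (componentwise minimum) for $\alpha,\beta\in S$; (G2) if $\alpha,\beta\in S$, $\alpha\ne\beta$, $\alpha_i=\beta_i$, there is $\epsilon\in S$ with $\epsilon_i>\alpha_i$, $\epsilon_j\ge\min(\alpha_j,\beta_j)$ for $j\ne i$, equality when $\alpha_j\ne\beta_j$; (G3) some $c\in S$ has $c+\mathbb N^d\subseteq S$. A good ideal is $E\subseteq S$ with $E+S\subseteq E$ satisfying (G1),(G2) inside $E$; conductor $c_E=\min\{\alpha:\alpha+\mathbb N^d\subseteq E\}$. For $X\subseteq\mathbb N^d$: $\Delta^X_F(\alpha)=\{\beta\in X:\beta_i=\alpha_i\ (i\in F),\ \beta_j>\alpha_j\ (j\notin F)\}$, $\widetilde\Delta^X_F(\alpha)=\{\beta\in X:\beta_i=\alpha_i\ (i\in F),\ \beta_j\ge\alpha_j\ (j\notin F)\}\setminus\{\alpha\}$. For $\alpha\in\mathbb N^d$ with $\alpha_j=(c_E)_j$ for all $j\notin U$, the $U$-subspace $\alpha(U)$ is $\widetilde\Delta^{\mathbb N^d}_U(\alpha)$ if $U\ne I$ and $\{\alpha\}$ if $U=I$; it is a $U$-subspace of $X$ if $\alpha\in X$ ($X=E$, $A$, or $A_i$); $X(U)$ denotes the set of these. For $F\subsetneq U$: $\Delta^X_F(\alpha(U))=\{\beta(U)\in X(U):\beta_j=\alpha_j\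 (j\in F),\ \beta_j>\alpha_j\ (j\in U\setminus F)\}$ and $\widetilde\Delta^X_F(\alpha(U))=\{\beta(U)\in X(U):\beta_j=\alpha_j\ (j\in F),\ \beta_j\ge\alpha_j\ (j\in U\setminus F)\}\setminus\{\alpha(U)\}$ (same formula used for $G\subseteq U$). Levels $A_i$ of $A$: define $\alpha\ll\beta$ iff $\alpha_i<\beta_i$ for all $i$; $\alpha$ is a complete infimum of $\beta^{(1)},\dots,\beta^{(r)}\in Y$ ($r\ge2$) if there are nonempty $F_j\subsetneq I$ with $\beta^{(j)}\in\Delta^S_{F_j}(\alpha)$, pairwise $\beta^{(j)}\wedge\beta^{(k)}=\alpha$, $\bigcap F_j=\emptyset$; inductively $B^{(i)}$ = $\ll$-maximal elements of $A\setminus(D^{(1)}\cup\cdots\cup D^{(i-1)})$, $C^{(i)}$ = elements of $B^{(i)}$ that are complete infima of $r$ elements of $B^{(i)}$ ($2\le r\le d$), $D^{(i)}=B^{(i)}\setminus C^{(i)}$; $A=D^{(1)}\cup\cdots\cup D^{(N)}$, $A_i:=D^{(N+1-i)}$. -}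

module Defs where

open import Data.Nat using (ℕ; zero; suc; _∸_; _+_; _≤_; _<_; _⊓_)
open import Data.Fin using (Fin)
open import Data.Fin.Subset using (Subset; _∈_; _∉_; _⊆_; _⊂_; ∁; _∪_; _∩_; Nonempty; ⊤)
open import Data.Product using (Σ; ∃; _×_; _,_)
open import Data.Sum using (_⊎_)
open import Data.Empty using (⊥)
open import Relation.Nullary using (¬_)
open import Relation.Binary.PropositionalEquality using (_≡_; _≢_)

Pt : ℕ → Set
Pt d = Fin d → ℕ

PSet : ℕ → Set₁
PSet d = Pt d → Set

module _ {d : ℕ} where

  0ᵖ : Pt d
  0ᵖ _ = 0

  _+ᵖ_ : Pt d → Pt d → Pt d
  (α +ᵖ β) i = α i + β i

  _∧ᵖ_ : Pt d → Pt d → Pt d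
  (α ∧ᵖ β) i = α i ⊓ β i

  _≤ᵖ_ : Pt d → Pt d → Set
  α ≤ᵖ β = ∀ i → α i ≤ β i

  _≈ᵖ_ : Pt d → Pt d → Set
  α ≈ᵖ β = ∀ i → α i ≡ β i

  _≪_ : Pt d → Pt d → Set
  α ≪ β = ∀ i → α i < β i

  G1 : PSet d → Set
  G1 X = ∀ α β → X α → X β → X (α ∧ᵖ β)

  G2 : PSet d → Set
  G2 X = ∀ α β (i : Fin d) → X α → X β → ¬ (α ≈ᵖ β) → α i ≡ β i →
         ∃ λ ε → X ε × α i < ε i
                 × (∀ j → j ≢ i → (α j ⊓ β j) ≤ ε j)
                 × (∀ j → j ≢ i → α j ≢ β j → ε j ≡ α j ⊓ β j)

  G3 : PSet d → Set
  G3 X = ∃ λ c → ∀ n → X (c +ᵖ n)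

  record GoodSemigroup (S : PSet d) : Set where
    field
      zero∈ : S 0ᵖ
      +-closed : ∀ α β → S α → S β → S (α +ᵖ β)
      g1 : G1 S
      g2 : G2 S
      g3 : G3 S

  record GoodIdeal (S E : PSet d) : Set where
    field
      ⊆S : ∀ α → E α → S α
      ideal : ∀ α β → E α → S β → E (α +ᵖ β)
      g1 : G1 E
      g2 : G2 E

  IsConductor : PSet d → Pt d → Set
  IsConductor E c = (∀ n → E (c +ᵖ n))
                  × (∀ γ → (∀ n → E (γ +ᵖ n)) → c ≤ᵖ γ)

  Δ : PSet d → Subset d → Pt d → Pt d → Set
  Δ X F α β = X β × (∀ i → i ∈ F → β i ≡ α i) × (∀ j → j ∉ F → α j < β j)

  Δ̃ : PSet d → Subset d → Pt d → Pt d → Set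
  Δ̃ X F α β = X β × (∀ i → i ∈ F → β i ≡ α i) × (∀ j → j ∉ F → α j ≤ β j)
              × ¬ (β ≈ᵖ α)

  -- α is the representative of a U-subspace α(U) (w.r.t. conductor c):
  -- α_j = c_j for all j ∉ U.  The subspace α(U) is identified with α.
  IsUSub : Pt d → Subset d → Pt d → Set
  IsUSub c U α = ∀ j → j ∉ U → α j ≡ c j

  USubOf : PSet d → Pt d → Subset d → Pt d → Set
  USubOf X c U α = IsUSub c U α × X α

  ΔU : PSet d → Pt d → Subset d → Subset d → Pt d → Pt d → Set
  ΔU X c U F α β = USubOf X c U β × (∀ j → j ∈ F → β j ≡ α j)
                   × (∀ j → j ∈ U → j ∉ F → α j < β j)

  -- β(U) ∈ Δ̃^X_F(α(U))   (β(U) ≠ α(U) iff β ≠ α for representatives)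
  Δ̃U : PSet d → Pt d → Subset d → Subset d → Pt d → Pt d → Set
  Δ̃U X c U F α β = USubOf X c U β × (∀ j → j ∈ F → β j ≡ α j)
                   × (∀ j → j ∈ U → j ∉ F → α j ≤ β j) × ¬ (β ≈ᵖ α)

  CompleteInf : PSet d → PSet d → Pt d → Set
  CompleteInf S Y α =
    Σ ℕ λ r → 2 ≤ r × r ≤ d ×
    Σ (Fin r → Pt d) λ β → Σ (Fin r → Subset d) λ F →
      (∀ k → Y (β k))
      × (∀ k → Nonempty (F k) × F k ⊂ ⊤)
      × (∀ k → Δ S (F k) α (β k))
      × (∀ k l → k ≢ l → (β k ∧ᵖ β l) ≈ᵖ α)
      × (∀ i → ∃ λ k → i ∉ F k)

  Max≪ : PSet d → PSet d
  Max≪ Y α = Y α × ¬ (∃ λ β → Y β × α ≪ β)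

  module Levels (S A : PSet d) where
    mutual
      Removed : ℕ → PSet d
      Removed zero α = ⊥
      Removed (suc k) α = Removed k α ⊎ D k α

      -- B k = B^(k+1), C k = C^(k+1), D k = D^(k+1)
      B : ℕ → PSet d
      B k = Max≪ (λ α → A α × ¬ Removed k α)

      C : ℕ → PSet d
      C k α = B k α × CompleteInf S (B k) α

      D : ℕ → PSet d
      D k α = B k α × ¬ C k α

  Compl : PSet d → PSet d → PSet d
  Compl S E α = S α × ¬ E α

  IsNumLevels : PSet d → PSet d → ℕ → Set
  IsNumLevels S A N = ∀ α → A α → Levels.Removed S A N α

  -- the level A_i = D^(N+1-i)  (for 1 ≤ i ≤ N); 0-indexed D (N ∸ i)
  Level : PSet d → PSet d → ℕ → ℕ → PSet d
  Level S A N i = Levels.D S A (N ∸ i)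

  Claims : PSet d → Pt d → Subset d → Subset d → Pt d → Set
  Claims X c U F α =
    (∀ β → IsUSub c U β →
        ((ΔU X c U F α β → Δ X (F ∪ ∁ U) α β) × (Δ X (F ∪ ∁ U) α β → ΔU X c U F α β))
      × ((Δ̃U X c U F α β → Δ̃ X (F ∪ ∁ U) α β) × (Δ̃ X (F ∪ ∁ U) α β → Δ̃U X c U F α β)))
    × (∀ G → (∁ F ∩ U) ⊆ G → G ⊆ U → ∀ β → USubOf X c U β →
        (Δ̃U X c U G α β → Δ̃ X G α β) × (Δ̃ X G α β → Δ̃U X c U G α β))

-- A U-subspace is represented by a point whose coordinates outside U are pinned to
-- those of the conductor, so two representatives always agree off U. Hence every
-- coordinate condition imposed on the complement of U holds automatically
-- (equalities hold, and so do non-strict inequalities), and membership conditions on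
-- subspaces translate verbatim into conditions on their representatives. Nothing
-- about X is used, nor F ⊊ U, nor the bounds on G: the USub⇒Claims hold for every subset
-- of ℕ^d, in particular for E, for A = S ∖ E and for each level of A.
module Submission where

open import Defs
open import Data.Nat using (ℕ; _≤_; _<_)
open import Data.Nat.Properties using (≤-reflexive)
open import Data.Fin.Subset using (Subset; _⊂_; Nonempty; _∈_; _∉_; ∁; _∪_)
open import Data.Fin.Subset.Properties using (x∈p∪q⁻; x∈p∪q⁺; x∉∁p⇒x∈p; x∈∁p⇒x∉p; _∈?_)
open import Data.Product using (_×_; _,_; proj₁)
open import Data.Sum using (inj₁; inj₂)
open import Relation.Nullary using (yes; no)
open import Relation.Binary.PropositionalEquality using (_≡_; sym; trans)

module _ {d : ℕ} {U F : Subset d} where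

  ∉-∪-∁⇒∈-∖ : ∀ {j} → j ∉ F ∪ ∁ U → j ∈ U × j ∉ F
  ∉-∪-∁⇒∈-∖ j∉ = x∉∁p⇒x∈p (λ j∈∁U → j∉ (x∈p∪q⁺ (inj₂ j∈∁U))) , (λ j∈F → j∉ (x∈p∪q⁺ (inj₁ j∈F)))

  ∈-∖⇒∉-∪-∁ : ∀ {j} → j ∈ U → j ∉ F → j ∉ F ∪ ∁ U
  ∈-∖⇒∉-∪-∁ j∈U j∉F j∈ with x∈p∪q⁻ F (∁ U) j∈
  ... | inj₁ j∈F  = j∉F j∈F
  ... | inj₂ j∈∁U = x∈∁p⇒x∉p j∈∁U j∈U

  agree-on-∪⇒agree-on-F : ∀ {α β : Pt d} → (∀ i → i ∈ F ∪ ∁ U → β i ≡ α i) → ∀ i → i ∈ F → β i ≡ α i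
  agree-on-∪⇒agree-on-F agree i i∈F = agree i (x∈p∪q⁺ (inj₁ i∈F))

module _ {d : ℕ} {c α β : Pt d} {U : Subset d} (αᵤ : IsUSub c U α) (βᵤ : IsUSub c U β) where

  USub-agree-off : ∀ j → j ∉ U → β j ≡ α j
  USub-agree-off j j∉U = trans (βᵤ j j∉U) (sym (αᵤ j j∉U))

  USub-agree-on-∪-∁ : ∀ {F} → (∀ i → i ∈ F → β i ≡ α i) → ∀ i → i ∈ F ∪ ∁ U → β i ≡ α i
  USub-agree-on-∪-∁ {F} agree i i∈ with x∈p∪q⁻ F (∁ U) i∈
  ... | inj₁ i∈F  = agree i i∈F
  ... | inj₂ i∈∁U = USub-agree-off i (x∈∁p⇒x∉p i∈∁U)

  USub-≤-off-U : ∀ {G} → (∀ j → j ∈ U → j ∉ G → α j ≤ β j) → ∀ j → j ∉ G → α j ≤ β j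
  USub-≤-off-U ≤-on-U j j∉G with j ∈? U
  ... | yes j∈U = ≤-on-U j j∈U j∉G
  ... | no  j∉U = ≤-reflexive (sym (USub-agree-off j j∉U))

module _ {d : ℕ} {U F : Subset d} {α β : Pt d} (R : ℕ → ℕ → Set) where

  on-∖⇒off-∪-∁ : (∀ j → j ∈ U → j ∉ F → R (α j) (β j)) → ∀ j → j ∉ F ∪ ∁ U → R (α j) (β j)
  on-∖⇒off-∪-∁ r j j∉ = let (j∈U , j∉F) = ∉-∪-∁⇒∈-∖ j∉ in r j j∈U j∉F

  off-∪-∁⇒on-∖ : (∀ j → j ∉ F ∪ ∁ U → R (α j) (β j)) → ∀ j → j ∈ U → j ∉ F → R (α j) (β j)
  off-∪-∁⇒on-∖ r j j∈U j∉F = r j (∈-∖⇒∉-∪-∁ j∈U j∉F)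

module _ {d : ℕ} (X : PSet d) (c : Pt d) (U : Subset d) {α β : Pt d}
         (αᵤ : IsUSub c U α) (βᵤ : IsUSub c U β) where

  ΔU⇒Δ-∪-∁ : ∀ {F} → ΔU X c U F α β → Δ X (F ∪ ∁ U) α β
  ΔU⇒Δ-∪-∁ ((_ , Xβ) , agree , grow) = Xβ , USub-agree-on-∪-∁ αᵤ βᵤ agree , on-∖⇒off-∪-∁ _<_ grow

  Δ⇒ΔU-∪-∁ : ∀ {F} → Δ X (F ∪ ∁ U) α β → ΔU X c U F α β
  Δ⇒ΔU-∪-∁ (Xβ , agree , grow) = (βᵤ , Xβ) , agree-on-∪⇒agree-on-F agree , off-∪-∁⇒on-∖ _<_ grow

  Δ̃U⇒Δ̃-∪-∁ : ∀ {F} → Δ̃U X c U F α β → Δ̃ X (F ∪ ∁ U) α β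
  Δ̃U⇒Δ̃-∪-∁ ((_ , Xβ) , agree , grow , β≉α) =
    Xβ , USub-agree-on-∪-∁ αᵤ βᵤ agree , on-∖⇒off-∪-∁ _≤_ grow , β≉α

  Δ̃⇒Δ̃U-∪-∁ : ∀ {F} → Δ̃ X (F ∪ ∁ U) α β → Δ̃U X c U F α β
  Δ̃⇒Δ̃U-∪-∁ (Xβ , agree , grow , β≉α) =
    (βᵤ , Xβ) , agree-on-∪⇒agree-on-F agree , off-∪-∁⇒on-∖ _≤_ grow , β≉α

  Δ̃U⇒Δ̃ : ∀ {G} → Δ̃U X c U G α β → Δ̃ X G α β
  Δ̃U⇒Δ̃ ((_ , Xβ) , agree , grow , β≉α) = Xβ , agree , USub-≤-off-U αᵤ βᵤ grow , β≉α

  Δ̃⇒Δ̃U : ∀ {G} → Δ̃ X G α β → Δ̃U X c U G α β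
  Δ̃⇒Δ̃U (Xβ , agree , grow , β≉α) = (βᵤ , Xβ) , agree , (λ j _ j∉G → grow j j∉G) , β≉α

USub⇒Claims : ∀ {d} (X : PSet d) (c : Pt d) (U F : Subset d) (α : Pt d) →
  IsUSub c U α → Claims X c U F α
USub⇒Claims X c U F α αᵤ =
  (λ β βᵤ → (ΔU⇒Δ-∪-∁ X c U αᵤ βᵤ , Δ⇒ΔU-∪-∁ X c U αᵤ βᵤ) , (Δ̃U⇒Δ̃-∪-∁ X c U αᵤ βᵤ , Δ̃⇒Δ̃U-∪-∁ X c U αᵤ βᵤ))
  , (λ G _ _ β (βᵤ , _) → Δ̃U⇒Δ̃ X c U αᵤ βᵤ , Δ̃⇒Δ̃U X c U αᵤ βᵤ)

lemma3p4 : (d : ℕ) (S E : PSet d) (c : Pt d) (U F : Subset d) (α : Pt d) →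
    GoodSemigroup S → GoodIdeal S E → IsConductor E c →
    Nonempty U → F ⊂ U →
    -- statement for E
    (USubOf E c U α → Claims E c U F α)
    -- statement for A = S ∖ E
    × (USubOf (Compl S E) c U α → Claims (Compl S E) c U F α)
    -- statement for each level A_i of A
    × (∀ N → IsNumLevels S (Compl S E) N → ∀ i → 1 ≤ i → i ≤ N →
         USubOf (Level S (Compl S E) N i) c U α →
         Claims (Level S (Compl S E) N i) c U F α)
lemma3p4 d S E c U F α _ _ _ _ _ =
  (λ αₓ → USub⇒Claims E c U F α (proj₁ αₓ))
  , (λ αₓ → USub⇒Claims (Compl S E) c U F α (proj₁ αₓ))
  , (λ N _ i _ _ αₓ → USub⇒Claims (Level S (Compl S E) N i) c U F α (proj₁ αₓ))
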